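{- For odd $n\ge 3$, let $G_n$ be the graph with vertex set $V_n=\{v^0_0,v^0_1\}\cup\{v^i_0,v^i_1,v^i_2,v^i_3: 1\le i\le n\}$ and edge set $E_n^0\cup E_n^1$, where $E_n^0=\{v^0_0v^0_1\}\cup\{v^i_1v^i_0,v^i_1v^i_2,v^i_1v^i_3,v^i_2v^i_3: 1\le i\le n\}$ and $E_n^1=\{v^i_0v^{i+1}_2,\ v^i_3v^{i+1}_0: 0\le i\le n\}$, where upper indices are taken modulo $n+1$ and we set $v^0_2:=v^0_1$ and $v^0_3:=v^0_1$. Let $\mathcal{G}'=\{G_n: n\ge 3\text{ odd}\}$. Then for every $G\in\mathcal{G}'$, $\chi_i(G)=5$.
   Context: All graphs are simple. An injective $k$-colouring of $G$ is a map $c:V(G)\to\{1,\dots,k\}$ such that any two distinct vertices with a common neighbour get different colours; the injective chromatic number $\chi_i(G)$ is the least such $k$. -}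

module Defs where

open import Data.Nat using (ℕ; zero; suc; _<_)
open import Data.Nat.DivMod using (_mod_)
open import Data.Fin using (Fin; zero; suc; toℕ)
open import Data.Sum using (_⊎_)
open import Data.Product using (Σ; _×_)
open import Relation.Binary.PropositionalEquality using (_≡_; _≢_)
open import Relation.Nullary using (¬_)

record Graph : Set₁ where
  field
    V   : Set
    Adj : V → V → Set

open Graph public

IsInjectiveColouring : (G : Graph) (k : ℕ) → (V G → Fin k) → Set
IsInjectiveColouring G k c =
  ∀ (x y z : V G) → x ≢ y → Adj G x z → Adj G y z → c x ≢ c y

HasInjectiveColouring : Graph → ℕ → Set
HasInjectiveColouring G k = Σ (V G → Fin k) (IsInjectiveColouring G k)

InjChromaticNumberIs : Graph → ℕ → Set
InjChromaticNumberIs G k =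
  HasInjectiveColouring G k × (∀ m → m < k → ¬ HasInjectiveColouring G m)

-- Vertices of G_n:  top j = v^0_j (j ∈ {0,1}),  blk i j = v^{i+1}_j (i < n, j < 4).
data Vtx (n : ℕ) : Set where
  top : Fin 2 → Vtx n
  blk : Fin n → Fin 4 → Vtx n

-- vert i j = v^i_j for 0 ≤ i ≤ n, with v^0_2 = v^0_3 = v^0_1.
vert : ∀ {n} → Fin (suc n) → Fin 4 → Vtx n
vert zero zero    = top zero
vert zero (suc _) = top (suc zero)
vert (suc i) j    = blk i j

next : ∀ {n} → Fin (suc n) → Fin (suc n)
next {n} i = suc (toℕ i) mod suc n

data Edge (n : ℕ) : Vtx n → Vtx n → Set where
  e-top : Edge n (top zero) (top (suc zero))
  e10   : (i : Fin n) → Edge n (blk i (suc zero)) (blk i zero)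
  e12   : (i : Fin n) → Edge n (blk i (suc zero)) (blk i (suc (suc zero)))
  e13   : (i : Fin n) → Edge n (blk i (suc zero)) (blk i (suc (suc (suc zero))))
  e23   : (i : Fin n) → Edge n (blk i (suc (suc zero))) (blk i (suc (suc (suc zero))))
  e02   : (i : Fin (suc n)) → Edge n (vert i zero) (vert (next i) (suc (suc zero)))
  e30   : (i : Fin (suc n)) → Edge n (vert i (suc (suc (suc zero)))) (vert (next i) zero)

G : ℕ → Graph
G n = record { V = Vtx n ; Adj = λ x y → Edge n x y ⊎ Edge n y x }

{-# OPTIONS --safe #-}
module Submission where

-- Each block v₀v₁v₂v₃ of G_n is the triangle v₁v₂v₃ with the pendant v₀ attached at v₁.
-- In an injective 4-colouring, c(v₀) and c(v₁) both avoid {c(v₂), c(v₃)}, so either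
-- c(v₀) = c(v₁) (the block is matched) or the block uses all four colours, and
-- comparing consecutive blocks shows that all n blocks behave alike. If all are
-- matched, the colours of the pendants alternate with period two, so for odd n the
-- pendants of blocks 1 and n, both adjacent to v⁰₁, get the same colour. If none is,
-- v⁰₀ must take the fourth colour of block 1 (that of v¹₂) and of block n (that of
-- vⁿ₃), two neighbours of v⁰₀. With a fifth colour, used only on v¹₀ and v¹₁, an
-- injective colouring exists; it is checked neighbourhood by neighbourhood.

open import Defs
open import Data.Nat using (ℕ; zero; suc; _+_; _*_; _≤_; _<_; _%_; s≤s; z≤n)
open import Data.Nat.Properties using (≤-refl; <⇒≤; ≤-pred)
open import Data.Nat.DivMod using (m<n⇒m%n≡m; n%n≡0)
open import Data.Fin using (Fin; zero; suc; toℕ; fromℕ; inject₁; inject≤; _≟_)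
open import Data.Fin.Patterns using (0F; 1F; 2F; 3F; 4F)
open import Data.Fin.Properties
  using (all?; toℕ-injective; toℕ-fromℕ<; toℕ-fromℕ; toℕ-inject₁; toℕ<n; inject≤-injective)
open import Data.Fin.Relation.Unary.Top using (view; ‵fromℕ; ‵inject₁)
open import Data.List using (List; []; _∷_; map)
open import Data.List.Membership.Propositional using (_∈_)
open import Data.List.Membership.Propositional.Properties using (∈-map⁺)
open import Data.List.Relation.Unary.All as All using ()
open import Data.List.Relation.Unary.Any using (here; there)
open import Data.List.Relation.Unary.AllPairs using (_∷_)
open import Data.List.Relation.Unary.Unique.Propositional using (Unique)
open import Data.List.Relation.Unary.Unique.DecPropositional (_≟_ {5}) using (unique?)
open import Data.Product using (∃-syntax; _×_; _,_; proj₁; proj₂)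
open import Data.Sum using (_⊎_; inj₁; inj₂; [_,_]′)
open import Data.Empty using (⊥)
open import Function using (_∘_)
open import Relation.Nullary using (¬_; Dec; yes; no; contradiction)
open import Relation.Nullary.Decidable using (True; toWitness; ¬?; _→-dec_; decidable-stable)
open import Relation.Binary.PropositionalEquality
  using (_≡_; _≢_; refl; sym; trans; cong; ≢-sym; module ≡-Reasoning)

fourth-colour-unique : ∀ {x y z u w : Fin 4} → x ≢ y → x ≢ z → y ≢ z →
                       u ≢ x → u ≢ y → u ≢ z → w ≢ x → w ≢ y → w ≢ z → u ≡ w
fourth-colour-unique {x} {y} {z} {u} {w} = toWitness {a? =
  all? λ x → all? λ y → all? λ z → all? λ u → all? λ w →
    x ≢? y →-dec x ≢? z →-dec y ≢? z →-dec u ≢? x →-dec u ≢? y →-dec u ≢? z →-dec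
    w ≢? x →-dec w ≢? y →-dec w ≢? z →-dec u ≟ w} _ x y z u w
  where
  _≢?_ : (a b : Fin 4) → Dec (a ≢ b)
  a ≢? b = ¬? (a ≟ b)

-- q j is the colour of vⱼ. The fields are the pairs of vertices of a block with a
-- common neighbour; v₀ and v₁ have none.
record WellColouredBlock (q : Fin 4 → Fin 4) : Set where
  field
    0≢2 : q 0F ≢ q 2F
    0≢3 : q 0F ≢ q 3F
    2≢3 : q 2F ≢ q 3F
    1≢2 : q 1F ≢ q 2F
    1≢3 : q 1F ≢ q 3F

-- q and q′ colour consecutive blocks, which are joined by the edges v₀v′₂ and v₃v′₀.
record WellColouredLink (q q′ : Fin 4 → Fin 4) : Set where
  field
    0≢1′ : q 0F ≢ q′ 1F
    0≢3′ : q 0F ≢ q′ 3F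
    0′≢1 : q′ 0F ≢ q 1F
    0′≢2 : q′ 0F ≢ q 2F
    1≢2′ : q 1F ≢ q′ 2F
    1′≢3 : q′ 1F ≢ q 3F

Matched : (Fin 4 → Fin 4) → Set
Matched q = q 0F ≡ q 1F

module _ {q q′ : Fin 4 → Fin 4} where

  matched-forward : WellColouredBlock q′ → WellColouredLink q q′ → Matched q → Matched q′
  matched-forward B′ L m = decidable-stable (q′ 0F ≟ q′ 1F) λ ¬m′ →
    L.0′≢1 (trans (sym (q₀≡q′₀ ¬m′)) m)
    where
    module B′ = WellColouredBlock B′
    module L = WellColouredLink L
    q₀≡q′₀ : ¬ Matched q′ → q 0F ≡ q′ 0F
    q₀≡q′₀ ¬m′ = fourth-colour-unique B′.1≢2 B′.1≢3 B′.2≢3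
      L.0≢1′ (λ e → L.1≢2′ (trans (sym m) e)) L.0≢3′
      ¬m′ B′.0≢2 B′.0≢3

  matched-backward : WellColouredBlock q → WellColouredLink q q′ → Matched q′ → Matched q
  matched-backward B L m′ = decidable-stable (q 0F ≟ q 1F) λ ¬m →
    L.0≢1′ (trans (q₀≡q′₀ ¬m) m′)
    where
    module B = WellColouredBlock B
    module L = WellColouredLink L
    q₀≡q′₀ : ¬ Matched q → q 0F ≡ q′ 0F
    q₀≡q′₀ ¬m = fourth-colour-unique B.1≢2 B.1≢3 B.2≢3
      ¬m B.0≢2 B.0≢3
      L.0′≢1 L.0′≢2 (λ e → L.1′≢3 (trans (sym m′) e))

matched-period-two : ∀ {q q′ q″} → WellColouredBlock q′ →
                     WellColouredLink q q′ → WellColouredLink q′ q″ →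
                     Matched q → Matched q′ → Matched q″ → q 0F ≡ q″ 0F
matched-period-two B′ L L′ m m′ m″ = fourth-colour-unique B′.0≢2 B′.0≢3 B′.2≢3
  (λ e → L.0≢1′ (trans e m′)) (λ e → L.1≢2′ (trans (sym m) e)) L.0≢3′
  (λ e → L′.0′≢1 (trans e m′)) L′.0′≢2 (λ e → L′.1′≢3 (trans (sym m″) e))
  where
  module B′ = WellColouredBlock B′
  module L = WellColouredLink L
  module L′ = WellColouredLink L′

record WellColouredChain (n : ℕ) (q : ℕ → Fin 4 → Fin 4) : Set where
  field
    block : ∀ {s} → s < n → WellColouredBlock (q s)
    link  : ∀ {s} → suc s < n → WellColouredLink (q s) (q (suc s))

module _ {n : ℕ} {q : ℕ → Fin 4 → Fin 4} (chain : WellColouredChain n q) where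
  open WellColouredChain chain

  private
    along : {P : ℕ → Set} → P 0 → (∀ {s} → suc s < n → P s → P (suc s)) →
            ∀ {s} → s < n → P s
    along P₀ step {zero}  _     = P₀
    along P₀ step {suc s} s+1<n = step s+1<n (along P₀ step (<⇒≤ s+1<n))

  uniform-matching : (∀ {s} → s < n → Matched (q s)) ⊎ (∀ {s} → s < n → ¬ Matched (q s))
  uniform-matching with q 0 0F ≟ q 0 1F
  ... | yes m = inj₁ (along {Matched ∘ q} m λ s+1<n →
                  matched-forward (block s+1<n) (link s+1<n))
  ... | no ¬m = inj₂ (along {¬_ ∘ Matched ∘ q} ¬m λ s+1<n ¬mₛ mₛ₊₁ →
                  ¬mₛ (matched-backward (block (<⇒≤ s+1<n)) (link s+1<n) mₛ₊₁))

  matched-pendants-even : (∀ {s} → s < n → Matched (q s)) →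
                          ∀ h → h * 2 < n → q 0 0F ≡ q (h * 2) 0F
  matched-pendants-even matched zero    _ = refl
  matched-pendants-even matched (suc h) p = trans
    (matched-pendants-even matched h (<⇒≤ (<⇒≤ p)))
    (matched-period-two (block (<⇒≤ p)) (link (<⇒≤ p)) (link p)
      (matched (<⇒≤ (<⇒≤ p))) (matched (<⇒≤ p)) (matched p))

toℕ-next : ∀ {n} (l : Fin (suc n)) → toℕ (next l) ≡ suc (toℕ l) % suc n
toℕ-next l = toℕ-fromℕ< _

next-inject₁ : ∀ {n} (i : Fin n) → next (inject₁ i) ≡ suc i
next-inject₁ {n} i = toℕ-injective (begin
  toℕ (next (inject₁ i))        ≡⟨ toℕ-next (inject₁ i) ⟩
  suc (toℕ (inject₁ i)) % suc n ≡⟨ cong (λ t → suc t % suc n) (toℕ-inject₁ i) ⟩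
  suc (toℕ i) % suc n           ≡⟨ m<n⇒m%n≡m (s≤s (toℕ<n i)) ⟩
  suc (toℕ i)                   ∎)
  where open ≡-Reasoning

next-fromℕ : ∀ n → next (fromℕ n) ≡ zero
next-fromℕ n = toℕ-injective (begin
  toℕ (next (fromℕ n))        ≡⟨ toℕ-next (fromℕ n) ⟩
  suc (toℕ (fromℕ n)) % suc n ≡⟨ cong (λ t → suc t % suc n) (toℕ-fromℕ n) ⟩
  suc n % suc n               ≡⟨ n%n≡0 (suc n) ⟩
  0                           ∎)
  where open ≡-Reasoning

layer : ∀ {n} → ℕ → Fin (suc n)
layer zero    = zero
layer (suc t) = next (layer t)

toℕ-layer : ∀ {n t} → t ≤ n → toℕ (layer {n} t) ≡ t
toℕ-layer {t = zero}  _   = refl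
toℕ-layer {n} {suc t} t<n = begin
  toℕ (next (layer t))            ≡⟨ toℕ-next (layer t) ⟩
  suc (toℕ (layer {n} t)) % suc n ≡⟨ cong (λ u → suc u % suc n) (toℕ-layer (<⇒≤ t<n)) ⟩
  suc t % suc n                   ≡⟨ m<n⇒m%n≡m (s≤s t<n) ⟩
  suc t                           ∎
  where open ≡-Reasoning

layer-injective : ∀ {n t u} → t ≤ n → u ≤ n → layer {n} t ≡ layer u → t ≡ u
layer-injective t≤n u≤n e = trans (sym (toℕ-layer t≤n)) (trans (cong toℕ e) (toℕ-layer u≤n))

layer-suc≢zero : ∀ {n s} → s < n → layer {n} (suc s) ≢ zero
layer-suc≢zero s<n e with layer-injective s<n z≤n e
... | ()

layer-wraps : ∀ {n} → layer {n} (suc n) ≡ zero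
layer-wraps {n} = trans (cong next layer-n≡fromℕ) (next-fromℕ n)
  where
  layer-n≡fromℕ : layer n ≡ fromℕ n
  layer-n≡fromℕ = toℕ-injective (trans (toℕ-layer ≤-refl) (sym (toℕ-fromℕ n)))

vert-injective : ∀ {n} {l l′ : Fin (suc n)} j → vert l j ≡ vert l′ j → l ≡ l′
vert-injective {l = zero}  {zero}  _       _    = refl
vert-injective {l = suc _} {suc _} _       refl = refl
vert-injective {l = zero}  {suc _} 0F      ()
vert-injective {l = zero}  {suc _} (suc _) ()
vert-injective {l = suc _} {zero}  0F      ()
vert-injective {l = suc _} {zero}  (suc _) ()

edge02 : ∀ {n} {l l′ : Fin (suc n)} → next l ≡ l′ → Edge n (vert l 0F) (vert l′ 2F)
edge02 {l = l} refl = e02 l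

edge30 : ∀ {n} {l l′ : Fin (suc n)} → next l ≡ l′ → Edge n (vert l 3F) (vert l′ 0F)
edge30 {l = l} refl = e30 l

module InjectiveFourColouring {n : ℕ} (c : Vtx n → Fin 4)
                              (injective : IsInjectiveColouring (G n) 4 c) where

  separated : ∀ {x y z} → Adj (G n) x z → Adj (G n) y z → x ≢ y → c x ≢ c y
  separated xz yz x≢y = injective _ _ _ x≢y xz yz

  colours : Fin (suc n) → Fin 4 → Fin 4
  colours l j = c (vert l j)

  block-well-coloured : ∀ l → l ≢ zero → WellColouredBlock (colours l)
  block-well-coloured zero    l≢0 = contradiction refl l≢0
  block-well-coloured (suc i) _   = record
    { 0≢2 = separated (inj₂ (e10 i)) (inj₂ (e12 i)) λ ()
    ; 0≢3 = separated (inj₂ (e10 i)) (inj₂ (e13 i)) λ ()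
    ; 2≢3 = separated (inj₂ (e12 i)) (inj₂ (e13 i)) λ ()
    ; 1≢2 = separated (inj₁ (e13 i)) (inj₁ (e23 i)) λ ()
    ; 1≢3 = separated (inj₁ (e12 i)) (inj₂ (e23 i)) λ ()
    }

  link-well-coloured : ∀ {l l′} → next l ≡ l′ → l ≢ zero → l′ ≢ zero →
                       WellColouredLink (colours l) (colours l′)
  link-well-coloured {zero}           _    l≢0 _    = contradiction refl l≢0
  link-well-coloured {suc _} {zero}   _    _   l′≢0 = contradiction refl l′≢0
  link-well-coloured {suc i} {suc i′} l→l′ _   _    = record
    { 0≢1′ = separated (inj₁ (edge02 l→l′)) (inj₁ (e12 i′)) λ ()
    ; 0≢3′ = separated (inj₁ (edge02 l→l′)) (inj₂ (e23 i′)) λ ()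
    ; 0′≢1 = separated (inj₂ (edge30 l→l′)) (inj₁ (e13 i)) λ ()
    ; 0′≢2 = separated (inj₂ (edge30 l→l′)) (inj₁ (e23 i)) λ ()
    ; 1≢2′ = separated (inj₁ (e10 i)) (inj₂ (edge02 l→l′)) λ ()
    ; 1′≢3 = separated (inj₁ (e10 i′)) (inj₁ (edge30 l→l′)) λ ()
    }

  chain : WellColouredChain n (λ s → colours (layer (suc s)))
  chain = record
    { block = λ s<n → block-well-coloured _ (layer-suc≢zero s<n)
    ; link  = λ s+1<n → link-well-coloured refl (layer-suc≢zero (<⇒≤ s+1<n)) (layer-suc≢zero s+1<n)
    }

  top-colour-after : ∀ {l} → next zero ≡ l → l ≢ zero → ¬ Matched (colours l) →
                     c (top 0F) ≡ colours l 2F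
  top-colour-after {zero}  _   l≢0 _  = contradiction refl l≢0
  top-colour-after {suc i} 0→l l≢0 ¬m = fourth-colour-unique ¬m B.0≢3 B.1≢3
    (separated (inj₁ e-top) (inj₂ (edge30 0→l)) λ ())
    (separated (inj₁ (edge02 0→l)) (inj₁ (e12 i)) λ ())
    (separated (inj₁ (edge02 0→l)) (inj₂ (e23 i)) λ ())
    (≢-sym B.0≢2) (≢-sym B.1≢2) B.2≢3
    where module B = WellColouredBlock (block-well-coloured (suc i) l≢0)

  top-colour-before : ∀ {l} → next l ≡ zero → l ≢ zero → ¬ Matched (colours l) →
                      c (top 0F) ≡ colours l 3F
  top-colour-before {zero}  _   l≢0 _  = contradiction refl l≢0
  top-colour-before {suc i} l→0 l≢0 ¬m = fourth-colour-unique ¬m B.0≢2 B.1≢2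
    (separated (inj₁ e-top) (inj₁ (edge02 l→0)) λ ())
    (separated (inj₂ (edge30 l→0)) (inj₁ (e13 i)) λ ())
    (separated (inj₂ (edge30 l→0)) (inj₁ (e23 i)) λ ())
    (≢-sym B.0≢3) (≢-sym B.1≢3) (≢-sym B.2≢3)
    where module B = WellColouredBlock (block-well-coloured (suc i) l≢0)

  first-last-pendants-differ : ∀ {l₁ lₙ} → next zero ≡ l₁ → next lₙ ≡ zero → l₁ ≢ lₙ →
                               colours l₁ 0F ≢ colours lₙ 0F
  first-last-pendants-differ 0→l₁ lₙ→0 l₁≢lₙ =
    separated (inj₂ (edge30 0→l₁)) (inj₁ (edge02 lₙ→0)) (l₁≢lₙ ∘ vert-injective 0F)

  first-last-triangles-differ : ∀ {l₁ lₙ} → next zero ≡ l₁ → next lₙ ≡ zero → l₁ ≢ zero →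
                                colours l₁ 2F ≢ colours lₙ 3F
  first-last-triangles-differ {zero}          _    _    l₁≢0 = contradiction refl l₁≢0
  first-last-triangles-differ {suc _} {zero}  0→l₁ lₙ→0 _    =
    separated (inj₂ (edge02 0→l₁)) (inj₁ (edge30 lₙ→0)) λ ()
  first-last-triangles-differ {suc _} {suc _} 0→l₁ lₙ→0 _    =
    separated (inj₂ (edge02 0→l₁)) (inj₁ (edge30 lₙ→0)) λ ()

no-injective-4-colouring : ∀ h → ¬ HasInjectiveColouring (G (3 + h * 2)) 4
no-injective-4-colouring h (c , injective) = [ all-matched , all-unmatched ]′ (uniform-matching chain)
  where
  open InjectiveFourColouring c injective

  n : ℕ
  n = 3 + h * 2

  q : ℕ → Fin 4 → Fin 4
  q s = colours (layer (suc s))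

  first-block : layer {n} 1 ≢ zero
  first-block = layer-suc≢zero (s≤s z≤n)

  last-block : layer {n} n ≢ zero
  last-block = layer-suc≢zero ≤-refl

  first≢last : layer {n} 1 ≢ layer n
  first≢last e with layer-injective (s≤s z≤n) ≤-refl e
  ... | ()

  -- The last block has the even index suc h * 2 = n − 1.
  all-matched : (∀ {s} → s < n → Matched (q s)) → ⊥
  all-matched matched = first-last-pendants-differ refl layer-wraps first≢last
    (matched-pendants-even chain matched (suc h) ≤-refl)

  all-unmatched : (∀ {s} → s < n → ¬ Matched (q s)) → ⊥
  all-unmatched unmatched = first-last-triangles-differ refl layer-wraps first-block
    (trans (sym (top-colour-after refl first-block (unmatched (s≤s z≤n))))
           (top-colour-before layer-wraps last-block (unmatched ≤-refl)))

unique-map-injective : ∀ {A B : Set} {f : A → B} {xs x y} →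
                       Unique (map f xs) → x ∈ xs → y ∈ xs → f x ≡ f y → x ≡ y
unique-map-injective _            (here refl) (here refl) _ = refl
unique-map-injective (fx∉ ∷ _)    (here refl) (there y∈)  e =
  contradiction e (All.lookup fx∉ (∈-map⁺ _ y∈))
unique-map-injective (fy∉ ∷ _)    (there x∈)  (here refl) e =
  contradiction (sym e) (All.lookup fy∉ (∈-map⁺ _ x∈))
unique-map-injective (_ ∷ unique) (there x∈)  (there y∈)  e = unique-map-injective unique x∈ y∈ e

rainbow-neighbourhoods⇒injective : ∀ (H : Graph) {k} (c : V H → Fin k) (N : V H → List (V H)) →
                                   (∀ {x z} → Adj H x z → x ∈ N z) →
                                   (∀ z → Unique (map c (N z))) → IsInjectiveColouring H k c
rainbow-neighbourhoods⇒injective H c N complete rainbow x y z x≢y xz yz cx≡cy =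
  x≢y (unique-map-injective (rainbow z) (complete xz) (complete yz) cx≡cy)

-- The layer before suc i is inject₁ i, and the layer before zero is fromℕ n.
neighbours : ∀ {n} → Vtx n → List (Vtx n)
neighbours (top 0F)   = top 1F ∷ vert (next 0F) 2F ∷ vert (fromℕ _) 3F ∷ []
neighbours (top 1F)   = top 0F ∷ vert (next 0F) 0F ∷ vert (fromℕ _) 0F ∷ []
neighbours (blk i 0F) = blk i 1F ∷ vert (next (suc i)) 2F ∷ vert (inject₁ i) 3F ∷ []
neighbours (blk i 1F) = blk i 0F ∷ blk i 2F ∷ blk i 3F ∷ []
neighbours (blk i 2F) = blk i 1F ∷ blk i 3F ∷ vert (inject₁ i) 0F ∷ []
neighbours (blk i 3F) = blk i 1F ∷ blk i 2F ∷ vert (next (suc i)) 0F ∷ []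

module _ {n : ℕ} where

  forward-neighbours : ∀ (l : Fin (suc n)) →
    vert (next l) 2F ∈ neighbours (vert l 0F) × vert (next l) 0F ∈ neighbours (vert l 3F)
  forward-neighbours zero    = there (here refl) , there (here refl)
  forward-neighbours (suc i) = there (here refl) , there (there (here refl))

  backward-neighbours : ∀ (l : Fin (suc n)) →
    vert l 0F ∈ neighbours (vert (next l) 2F) × vert l 3F ∈ neighbours (vert (next l) 0F)
  backward-neighbours l with view l
  ... | ‵fromℕ     rewrite next-fromℕ n   = there (there (here refl)) , there (there (here refl))
  ... | ‵inject₁ i rewrite next-inject₁ i = there (there (here refl)) , there (there (here refl))

  edge-neighbours : ∀ {x y} → Edge n x y → x ∈ neighbours y × y ∈ neighbours x
  edge-neighbours e-top   = here refl , here refl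
  edge-neighbours (e10 i) = here refl , here refl
  edge-neighbours (e12 i) = here refl , there (here refl)
  edge-neighbours (e13 i) = here refl , there (there (here refl))
  edge-neighbours (e23 i) = there (here refl) , there (here refl)
  edge-neighbours (e02 l) = proj₁ (backward-neighbours l) , proj₁ (forward-neighbours l)
  edge-neighbours (e30 l) = proj₂ (backward-neighbours l) , proj₂ (forward-neighbours l)

  adjacent⇒neighbour : ∀ {x z} → Adj (G n) x z → x ∈ neighbours z
  adjacent⇒neighbour (inj₁ xz) = proj₁ (edge-neighbours xz)
  adjacent⇒neighbour (inj₂ zx) = proj₂ (edge-neighbours zx)

colouring₅ : ∀ {n} → Vtx n → Fin 5
colouring₅ (top 0F)        = 4F
colouring₅ (top 1F)        = 1F
colouring₅ (blk 0F 0F)     = 0F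
colouring₅ (blk 0F 1F)     = 0F
colouring₅ (blk 0F 2F)     = 2F
colouring₅ (blk 0F 3F)     = 1F
colouring₅ (blk (suc _) j) = suc j

rainbow : {cs : List (Fin 5)} → True (unique? cs) → Unique cs
rainbow = toWitness

-- next computes on numerals once n ≥ 3, so only the symbolic cases need a rewrite.
neighbourhoods-rainbow : ∀ {m} (z : Vtx (3 + m)) → Unique (map colouring₅ (neighbours z))
neighbourhoods-rainbow (top 0F)               = rainbow _
neighbourhoods-rainbow (top 1F)               = rainbow _
neighbourhoods-rainbow (blk 0F 1F)            = rainbow _
neighbourhoods-rainbow (blk (suc _) 1F)       = rainbow _
neighbourhoods-rainbow (blk 0F 2F)            = rainbow _
neighbourhoods-rainbow (blk 1F 2F)            = rainbow _
neighbourhoods-rainbow (blk (suc (suc _)) 2F) = rainbow _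
neighbourhoods-rainbow {m} (blk i 0F) with view i
... | ‵fromℕ rewrite next-fromℕ (3 + m) = rainbow _
... | ‵inject₁ 0F = rainbow _
... | ‵inject₁ 1F = rainbow _
... | ‵inject₁ (suc (suc j)) rewrite next-inject₁ (suc (suc (suc j))) = rainbow _
neighbourhoods-rainbow {m} (blk i 3F) with view i
... | ‵fromℕ rewrite next-fromℕ (3 + m) = rainbow _
... | ‵inject₁ 0F = rainbow _
... | ‵inject₁ (suc j) rewrite next-inject₁ (suc (suc j)) = rainbow _

injective-5-colouring : ∀ m → HasInjectiveColouring (G (3 + m)) 5
injective-5-colouring m = colouring₅ ,
  rainbow-neighbourhoods⇒injective (G (3 + m)) colouring₅ neighbours
    adjacent⇒neighbour neighbourhoods-rainbow

injective-colouring-mono : ∀ {H : Graph} {k m} → k ≤ m →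
                           HasInjectiveColouring H k → HasInjectiveColouring H m
injective-colouring-mono k≤m (c , injective) =
  (λ v → inject≤ (c v) k≤m) ,
  λ x y z x≢y xz yz e → injective x y z x≢y xz yz (inject≤-injective k≤m k≤m _ _ e)

odd≥3⇒≡3+h*2 : ∀ n → n % 2 ≡ 1 → 3 ≤ n → ∃[ h ] n ≡ 3 + h * 2
odd≥3⇒≡3+h*2 0 _ ()
odd≥3⇒≡3+h*2 1 _ (s≤s ())
odd≥3⇒≡3+h*2 2 _ (s≤s (s≤s ()))
odd≥3⇒≡3+h*2 3 _ _ = 0 , refl
odd≥3⇒≡3+h*2 4 () _
odd≥3⇒≡3+h*2 (suc (suc (suc (suc (suc n))))) odd _
  with odd≥3⇒≡3+h*2 (3 + n) odd (s≤s (s≤s (s≤s z≤n)))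
... | h , refl = suc h , refl

theorem10 : ∀ (n : ℕ) → n % 2 ≡ 1 → 3 ≤ n → InjChromaticNumberIs (G n) 5
theorem10 n odd 3≤n with odd≥3⇒≡3+h*2 n odd 3≤n
... | h , refl = injective-5-colouring (h * 2) , λ k k<5 colouring →
  no-injective-4-colouring h (injective-colouring-mono (≤-pred k<5) colouring)
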